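{- Assume propositional truncations and function extensionality for $\mathbf{0}$-valued functions. Suppose $P,Q:\mathcal{U}\to\mathcal{U}$ are invariant under equivalence, that $P(Z)\vee Q(Z)$ holds for every $Z:\mathcal{U}$, and that there are types $X,Y:\mathcal{U}$ with $\neg P(X)$ and $\neg Q(Y)$. Then weak excluded middle holds.
   Context: Work in intensional Martin-Löf type theory with $\Pi$-, $\Sigma$-, identity, finite types and natural numbers, and a universe $\mathcal{U}$ closed under these, extended with propositional truncations $\|A\|$ (the universal proposition receiving a map from $A$). For propositions $A,B$, $A\vee B$ denotes $\|A+B\|$. $\neg A$ is $A\to\mathbf{0}$. Weak excluded middle: for all $A:\mathcal{U}$, $\neg A+\neg\neg A$. An equivalence is a map with a left and a right inverse; $X\simeq Y$ means there is an equivalence $X\to Y$. $P:\mathcal{U}\to\mathcal{U}$ is invariant under equivalence if $X\simeq Y$ implies $P(X)\simeq P(Y)$. -}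

module Defs where

open import Data.Empty using (⊥)
open import Data.Sum using (_⊎_)
open import Data.Product using (Σ; _×_)
open import Relation.Binary.PropositionalEquality using (_≡_)
open import Relation.Nullary using (¬_)

-- U is Set (= Set₀).

isProp : Set → Set
isProp A = (x y : A) → x ≡ y

-- Propositional truncation, assumed as structure (its universal property
-- for propositions in U).
record PropTrunc : Set₁ where
  field
    ∥_∥       : Set → Set
    ∥∥-isProp : {A : Set} → isProp ∥ A ∥
    ∣_∣       : {A : Set} → A → ∥ A ∥
    ∥∥-rec    : {A B : Set} → isProp B → (A → B) → ∥ A ∥ → B

FunextEmpty : Set₁
FunextEmpty = {A : Set} (f g : A → ⊥) → ((x : A) → f x ≡ g x) → f ≡ g

isEquiv : {X Y : Set} → (X → Y) → Set
isEquiv {X} {Y} f =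
  (Σ (Y → X) λ g → (x : X) → g (f x) ≡ x) ×
  (Σ (Y → X) λ h → (y : Y) → f (h y) ≡ y)

_≃_ : Set → Set → Set
X ≃ Y = Σ (X → Y) isEquiv

InvariantUnderEquiv : (Set → Set) → Set₁
InvariantUnderEquiv P = {X Y : Set} → X ≃ Y → P X ≃ P Y

WEM : Set₁
WEM = (A : Set) → ¬ A ⊎ ¬ ¬ A

-- Given A, form the type Z = (¬A × X) + (¬¬A × Y). If ¬A then Z ≃ X, so P Z
-- would give P X; if ¬¬A then Z ≃ Y, so Q Z would give Q Y. Hence the side of
-- P Z ∨ Q Z that holds decides between ¬¬A and ¬A, and since ¬A + ¬¬A is a
-- proposition the truncation can be eliminated.
module Submission where

open import Defs
open import Data.Sum using (_⊎_; inj₁; inj₂)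
open import Data.Product using (Σ; _×_; _,_; proj₁)
open import Data.Empty using (⊥-elim)
open import Relation.Nullary using (¬_)
open import Relation.Binary.PropositionalEquality using (_≡_; refl; cong)

¬-isProp : FunextEmpty → {A : Set} → isProp (¬ A)
¬-isProp fe f g = fe f g (λ a → ⊥-elim (f a))

⊎-isProp : {A B : Set} → isProp A → isProp B → ¬ (A × B) → isProp (A ⊎ B)
⊎-isProp pA pB disjoint (inj₁ a) (inj₁ a′) = cong inj₁ (pA a a′)
⊎-isProp pA pB disjoint (inj₁ a) (inj₂ b)  = ⊥-elim (disjoint (a , b))
⊎-isProp pA pB disjoint (inj₂ b) (inj₁ a)  = ⊥-elim (disjoint (a , b))
⊎-isProp pA pB disjoint (inj₂ b) (inj₂ b′) = cong inj₂ (pB b b′)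

WEM-instance-isProp : FunextEmpty → (A : Set) → isProp (¬ A ⊎ ¬ ¬ A)
WEM-instance-isProp fe A =
  ⊎-isProp (¬-isProp fe) (¬-isProp fe) (λ (na , nna) → nna na)

⊎-inhabitedˡ-≃ : {C D X Y : Set} → isProp C → C → ¬ D → ((C × X) ⊎ (D × Y)) ≃ X
⊎-inhabitedˡ-≃ {C} {D} {X} {Y} pC c ¬d = to , (from , from-to) , (from , λ _ → refl)
  where
  to : (C × X) ⊎ (D × Y) → X
  to (inj₁ (_ , x)) = x
  to (inj₂ (d , _)) = ⊥-elim (¬d d)

  from : X → (C × X) ⊎ (D × Y)
  from x = inj₁ (c , x)

  from-to : (z : (C × X) ⊎ (D × Y)) → from (to z) ≡ z
  from-to (inj₁ (c′ , x)) = cong (λ c″ → inj₁ (c″ , x)) (pC c c′)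
  from-to (inj₂ (d , _))  = ⊥-elim (¬d d)

⊎-inhabitedʳ-≃ : {C D X Y : Set} → ¬ C → isProp D → D → ((C × X) ⊎ (D × Y)) ≃ Y
⊎-inhabitedʳ-≃ {C} {D} {X} {Y} ¬c pD d = to , (from , from-to) , (from , λ _ → refl)
  where
  to : (C × X) ⊎ (D × Y) → Y
  to (inj₁ (c , _)) = ⊥-elim (¬c c)
  to (inj₂ (_ , y)) = y

  from : Y → (C × X) ⊎ (D × Y)
  from y = inj₂ (d , y)

  from-to : (z : (C × X) ⊎ (D × Y)) → from (to z) ≡ z
  from-to (inj₁ (c , _))  = ⊥-elim (¬c c)
  from-to (inj₂ (d′ , y)) = cong (λ d″ → inj₂ (d″ , y)) (pD d d′)

transport-≃ : {P : Set → Set} → InvariantUnderEquiv P → {X Y : Set} → X ≃ Y → P X → P Y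
transport-≃ invP e = proj₁ (invP e)

theorem2p11 : (pt : PropTrunc) → FunextEmpty →
    (P Q : Set → Set) → InvariantUnderEquiv P → InvariantUnderEquiv Q →
    ((Z : Set) → PropTrunc.∥_∥ pt (P Z ⊎ Q Z)) →
    (Σ Set λ X → Σ Set λ Y → ¬ P X × ¬ Q Y) →
    WEM
theorem2p11 pt fe P Q invP invQ P∨Q (X , Y , ¬PX , ¬QY) A =
  ∥∥-rec (WEM-instance-isProp fe A) decide (P∨Q Z)
  where
  open PropTrunc pt

  Z : Set
  Z = (¬ A × X) ⊎ (¬ ¬ A × Y)

  decide : P Z ⊎ Q Z → ¬ A ⊎ ¬ ¬ A
  decide (inj₁ PZ) = inj₂ λ ¬a →
    ¬PX (transport-≃ invP (⊎-inhabitedˡ-≃ (¬-isProp fe) ¬a (λ ¬¬a → ¬¬a ¬a)) PZ)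
  decide (inj₂ QZ) = inj₁ λ a →
    ¬QY (transport-≃ invQ (⊎-inhabitedʳ-≃ (λ ¬a → ¬a a) (¬-isProp fe) (λ ¬a → ¬a a)) QZ)
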